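{- Let $M$ be a positive integer and let $n_g$ be the number of gapsets of genus $g$. Then there exists a quasipolynomial $p_M$ of degree $M-2$ such that $$n_g\le \mathbf F^{\left(\left\lceil\frac{2g}{M+1}\right\rceil\right)}_{g+1}+p_M(g)$$ for all sufficiently large $g$.
   Context: A gapset is a finite set $G\subset\mathbb N$ (positive integers) such that whenever $z\in G$ and $z=x+y$ with $x,y\in\mathbb N$, then $x\in G$ or $y\in G$; its genus is $\#G$. For an integer $k\ge1$, the $k$-generalized Fibonacci sequence is defined by $\mathbf F^{(k)}_1=1$, $\mathbf F^{(k)}_i=0$ for $i\in[-k+2,0]$, and $\mathbf F^{(k)}_n=\sum_{i=1}^k\mathbf F^{(k)}_{n-i}$ for $n\ge2$; equivalently $\mathbf F^{(k)}_{g+1}$ is the number of compositions of $g$ with all parts in $\{1,\dots,k\}$. A quasipolynomial is a function $f:\mathbb N\to\mathbb C$ for which there exist a positive integer $t$ (the period) and polynomials $f_0,\dots,f_{t-1}$ with $f(n)=f_i(n)$ whenever $n\equiv i\pmod t$; its degree is the largest degree of the $f_i$. -}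

module Defs where

open import Data.Nat as ℕ using (ℕ; zero; suc; _∸_; _<_; _≤_; NonZero)
open import Data.Nat.DivMod using (_/_; _%_; m%n<n)
open import Data.Integer as ℤ using (ℤ; +_)
open import Data.Rational as ℚ using (ℚ; 0ℚ)
open import Data.Fin using (Fin; fromℕ<)
open import Data.Nat.ListAction using (sum)
open import Data.List using (List; []; _∷_; take; length)
open import Data.List.Membership.Propositional using (_∈_)
open import Data.List.Relation.Unary.Linked using (Linked)
open import Data.List.Relation.Unary.All using (All)
open import Data.Product using (Σ; ∃; _×_)
open import Data.Sum using (_⊎_)
open import Relation.Binary.PropositionalEquality using (_≡_; _≢_)

-- Finite sets of positive integers, represented canonically as
-- strictly increasing lists (so distinct lists = distinct sets).

IsFinPosSet : List ℕ → Set
IsFinPosSet G = All (λ x → 1 ≤ x) G × Linked _<_ G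

IsGapset : List ℕ → Set
IsGapset G = IsFinPosSet G ×
  (∀ z x y → z ∈ G → 1 ≤ x → 1 ≤ y → z ≡ x ℕ.+ y → (x ∈ G) ⊎ (y ∈ G))

IsGapsetOfGenus : ℕ → List ℕ → Set
IsGapsetOfGenus g G = IsGapset G × length G ≡ g

-- k-generalized Fibonacci numbers.
-- fibs k n = [F_n , F_{n-1} , … , F_0]  (for n ≥ 0), where F_0 = 0,
-- F_1 = 1, and F_n = Σ_{i=1}^k F_{n-i} for n ≥ 2 (indices ≤ 0 give 0,
-- so missing entries in 'take k' correctly contribute 0).

fibs : ℕ → ℕ → List ℕ
fibs k zero = 0 ∷ []
fibs k (suc zero) = 1 ∷ 0 ∷ []
fibs k (suc (suc m)) = let l = fibs k (suc m) in sum (take k l) ∷ l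

kFib : ℕ → ℕ → ℕ
kFib k n with fibs k n
... | [] = 0
... | x ∷ _ = x

⌈_/_⌉ : ℕ → (b : ℕ) → .{{NonZero b}} → ℕ
⌈ a / b ⌉ = (a ℕ.+ (b ∸ 1)) / b

-- Quasipolynomials (rational coefficients), with period t ≥ 1 and
-- constituents f_0, …, f_{t-1} given by coefficient lists
-- (constant term first).

record QuasiPolynomial : Set where
  field
    period   : ℕ
    .{{period-nonzero}} : NonZero period
    coeffs   : Fin period → List ℚ

coeffAt : List ℚ → ℕ → ℚ
coeffAt [] j = 0ℚ
coeffAt (c ∷ cs) zero = c
coeffAt (c ∷ cs) (suc j) = coeffAt cs j

evalPoly : List ℚ → ℚ → ℚ
evalPoly [] x = 0ℚ
evalPoly (c ∷ cs) x = c ℚ.+ x ℚ.* evalPoly cs x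

ℕ→ℚ : ℕ → ℚ
ℕ→ℚ n = (+ n) ℚ./ 1

evalQP : QuasiPolynomial → ℕ → ℚ
evalQP p n = evalPoly (coeffs (fromℕ< (m%n<n n period))) (ℕ→ℚ n)
  where open QuasiPolynomial p

-- degree: the largest degree of the constituents; the zero
-- quasipolynomial is given degree -1.
HasDegree : QuasiPolynomial → ℤ → Set
HasDegree p d =
  (∀ i j → d ℤ.< + j → coeffAt (coeffs i) j ≡ 0ℚ) ×
  (∀ j → d ≡ + j → ∃ λ i → coeffAt (coeffs i) j ≢ 0ℚ)
  where open QuasiPolynomial p

{-# OPTIONS --safe #-}
-- Send a gapset G of genus g to its Kunz coordinates: with m the least positive integer
-- outside G, the number k_r of gaps congruent to r modulo m, for 0 < r < m.  Every gap
-- is below 2g, and the complement of G is closed under addition, so the gaps of residue r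
-- are exactly r, r + m, …, r + (k_r − 1) m.  Hence G is recovered from (k_1, …, k_{m−1}),
-- each k_r is positive, they sum to g, and r + (k_r − 1) m < 2g bounds k_r by ⌈2g/(M+1)⌉
-- as soon as m > M.  So the coordinates are a composition of g either with parts at most
-- ⌈2g/(M+1)⌉, of which there are F^{(⌈2g/(M+1)⌉)}_{g+1}, or with fewer than M parts, of
-- which there are at most 1 + g + ⋯ + g^{M−2}.
module Submission where

module FiniteSums where

  open import Data.Nat using (ℕ; zero; suc; _+_; _*_; _∸_; _≤_; _<_; z≤n; s≤s; z<s; s<s; s≤s⁻¹; _≟_;
                              _≤′_; ≤′-refl; ≤′-step)
  open import Data.Nat.Properties
  open import Data.Nat.ListAction using (sum)
  open import Algebra.Properties.CommutativeSemigroup +-commutativeSemigroup using (interchange)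
  open import Data.Bool using (true; false; if_then_else_)
  open import Data.List using (List; []; _∷_; applyUpTo; length)
  open import Data.List.Membership.Propositional using (_∉_)
  open import Data.List.Membership.DecPropositional _≟_ using (_∈?_)
  open import Data.List.Relation.Unary.Any using (here)
  open import Data.List.Relation.Unary.All using (All; []; _∷_)
  open import Data.List.Relation.Unary.AllPairs using ([]; _∷_)
  open import Data.List.Relation.Unary.Unique.Propositional using (Unique)
  open import Data.List.Relation.Unary.Unique.Propositional.Properties using (Unique[x∷xs]⇒x∉xs)
  open import Data.Product using (_,_)
  open import Data.Sum using (inj₁; inj₂)
  open import Function using (_∘_)
  open import Relation.Nullary using (Dec; does; yes; no; ¬_; contradiction)
  open import Relation.Nullary.Decidable using (dec-true; dec-false)
  open import Relation.Unary using (Decidable)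
  open import Relation.Binary.PropositionalEquality using (_≡_; refl; sym; trans; cong; cong₂; module ≡-Reasoning)

  ∑ : ℕ → (ℕ → ℕ) → ℕ
  ∑ n f = sum (applyUpTo f n)

  syntax ∑ n (λ i → e) = ∑[ i < n ] e

  ∑-cong : ∀ {f h} n → (∀ i → i < n → f i ≡ h i) → ∑ n f ≡ ∑ n h
  ∑-cong zero    f≡h = refl
  ∑-cong (suc n) f≡h = cong₂ _+_ (f≡h 0 z<s) (∑-cong n (λ i i<n → f≡h (suc i) (s<s i<n)))

  ∑-mono-≤ : ∀ {f h} n → (∀ i → i < n → f i ≤ h i) → ∑ n f ≤ ∑ n h
  ∑-mono-≤ zero    f≤h = z≤n
  ∑-mono-≤ (suc n) f≤h = +-mono-≤ (f≤h 0 z<s) (∑-mono-≤ n (λ i i<n → f≤h (suc i) (s<s i<n)))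

  ∑-zero : ∀ n → ∑[ _ < n ] 0 ≡ 0
  ∑-zero zero    = refl
  ∑-zero (suc n) = ∑-zero n

  ∑-const : ∀ c n → ∑[ _ < n ] c ≡ n * c
  ∑-const c zero    = refl
  ∑-const c (suc n) = cong (c +_) (∑-const c n)

  n≤∑ : ∀ {f} n → (∀ i → i < n → 1 ≤ f i) → n ≤ ∑ n f
  n≤∑ {f} n 1≤f = begin
    n            ≡⟨ *-identityʳ n ⟨
    n * 1        ≡⟨ ∑-const 1 n ⟨
    ∑[ _ < n ] 1 ≤⟨ ∑-mono-≤ n 1≤f ⟩
    ∑ n f        ∎
    where open ≤-Reasoning

  ∑≤n : ∀ {f} n → (∀ i → i < n → f i ≤ 1) → ∑ n f ≤ n
  ∑≤n {f} n f≤1 = begin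
    ∑ n f        ≤⟨ ∑-mono-≤ n f≤1 ⟩
    ∑[ _ < n ] 1 ≡⟨ ∑-const 1 n ⟩
    n * 1        ≡⟨ *-identityʳ n ⟩
    n            ∎
    where open ≤-Reasoning

  ∑-distrib-+ : ∀ f h n → ∑[ i < n ] (f i + h i) ≡ ∑ n f + ∑ n h
  ∑-distrib-+ f h zero    = refl
  ∑-distrib-+ f h (suc n) =
    trans (cong (f 0 + h 0 +_) (∑-distrib-+ (f ∘ suc) (h ∘ suc) n)) (interchange (f 0) (h 0) _ _)

  ∑-split : ∀ f a b → ∑ (a + b) f ≡ ∑ a f + ∑[ i < b ] f (a + i)
  ∑-split f zero    b = refl
  ∑-split f (suc a) b = trans (cong (f 0 +_) (∑-split (f ∘ suc) a b)) (sym (+-assoc (f 0) _ _))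

  ∑-last : ∀ f n → ∑ (suc n) f ≡ ∑ n f + f n
  ∑-last f n = begin
    ∑ (suc n) f             ≡⟨ cong (λ k → ∑ k f) (+-comm 1 n) ⟩
    ∑ (n + 1) f             ≡⟨ ∑-split f n 1 ⟩
    ∑ n f + (f (n + 0) + 0) ≡⟨ cong (∑ n f +_) (trans (+-identityʳ _) (cong f (+-identityʳ n))) ⟩
    ∑ n f + f n             ∎
    where open ≡-Reasoning

  ∑-reverse : ∀ f n → ∑[ i < suc n ] f (n ∸ i) ≡ ∑ (suc n) f
  ∑-reverse f zero    = refl
  ∑-reverse f (suc n) = begin
    f (suc n) + ∑[ i < suc n ] f (n ∸ i) ≡⟨ cong (f (suc n) +_) (∑-reverse f n) ⟩
    f (suc n) + ∑ (suc n) f              ≡⟨ +-comm (f (suc n)) _ ⟩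
    ∑ (suc n) f + f (suc n)              ≡⟨ ∑-last f (suc n) ⟨
    ∑ (suc (suc n)) f                    ∎
    where open ≡-Reasoning

  ∑-comm : ∀ (h : ℕ → ℕ → ℕ) a b → ∑[ i < a ] ∑[ j < b ] h i j ≡ ∑[ j < b ] ∑[ i < a ] h i j
  ∑-comm h zero    b = sym (∑-zero b)
  ∑-comm h (suc a) b =
    trans (cong (∑ b (h 0) +_) (∑-comm (h ∘ suc) a b)) (sym (∑-distrib-+ (h 0) _ b))

  ∑-blocks : ∀ f a m → ∑ (a * m) f ≡ ∑[ j < a ] ∑[ r < m ] f (j * m + r)
  ∑-blocks f zero    m = refl
  ∑-blocks f (suc a) m = begin
    ∑ (m + a * m) f                                   ≡⟨ ∑-split f m (a * m) ⟩
    ∑ m f + ∑[ i < a * m ] f (m + i)                  ≡⟨ cong (∑ m f +_) (∑-blocks (λ i → f (m + i)) a m) ⟩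
    ∑ m f + ∑[ j < a ] ∑[ r < m ] f (m + (j * m + r)) ≡⟨ cong (∑ m f +_) (∑-cong a λ j _ → ∑-cong m λ r _ →
                                                          cong f (sym (+-assoc m (j * m) r))) ⟩
    ∑[ j < suc a ] ∑[ r < m ] f (j * m + r)           ∎
    where open ≡-Reasoning

  𝟙 : ∀ {p} {P : Set p} → Dec P → ℕ
  𝟙 P? = if does P? then 1 else 0

  𝟙-yes : ∀ {p} {P : Set p} (P? : Dec P) → P → 𝟙 P? ≡ 1
  𝟙-yes P? p = cong (λ b → if b then 1 else 0) (dec-true P? p)

  𝟙-no : ∀ {p} {P : Set p} (P? : Dec P) → ¬ P → 𝟙 P? ≡ 0
  𝟙-no P? ¬p = cong (λ b → if b then 1 else 0) (dec-false P? ¬p)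

  𝟙≤1 : ∀ {p} {P : Set p} (P? : Dec P) → 𝟙 P? ≤ 1
  𝟙≤1 P? with does P?
  ... | true  = ≤-refl
  ... | false = z≤n

  ∑𝟙-≟-≤1 : ∀ y N → ∑[ x < N ] 𝟙 (x ≟ y) ≤ 1
  ∑𝟙-≟-≤1 y       zero    = z≤n
  ∑𝟙-≟-≤1 zero    (suc N) = ≤-reflexive (cong suc (∑-zero N))
  ∑𝟙-≟-≤1 (suc y) (suc N) = ∑𝟙-≟-≤1 y N

  ∑𝟙-≟-≡1 : ∀ {y N} → y < N → ∑[ x < N ] 𝟙 (x ≟ y) ≡ 1
  ∑𝟙-≟-≡1 {zero}  {suc N} _         = cong suc (∑-zero N)
  ∑𝟙-≟-≡1 {suc y} {suc N} (s<s y<N) = ∑𝟙-≟-≡1 y<N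

  χ : List ℕ → ℕ → ℕ
  χ G x = 𝟙 (x ∈? G)

  χ-∷-≤ : ∀ x y G → χ (y ∷ G) x ≤ 𝟙 (x ≟ y) + χ G x
  χ-∷-≤ x y G with does (x ≟ y)
  ... | true  = s≤s z≤n
  ... | false = ≤-refl

  χ-∷-≡ : ∀ x {y G} → y ∉ G → χ (y ∷ G) x ≡ 𝟙 (x ≟ y) + χ G x
  χ-∷-≡ x {y} {G} y∉G with x ≟ y
  ... | no x≢y rewrite dec-false (x ≟ y) x≢y = refl
  ... | yes refl = begin
    𝟙 (x ∈? x ∷ G)         ≡⟨ 𝟙-yes (x ∈? x ∷ G) (here refl) ⟩
    1 + 0                  ≡⟨ cong₂ _+_ (𝟙-yes (x ≟ x) refl) (𝟙-no (x ∈? G) y∉G) ⟨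
    𝟙 (x ≟ x) + 𝟙 (x ∈? G) ∎
    where open ≡-Reasoning

  ∑χ≤length : ∀ G N → ∑ N (χ G) ≤ length G
  ∑χ≤length []      N = ≤-reflexive (∑-zero N)
  ∑χ≤length (y ∷ G) N = begin
    ∑ N (χ (y ∷ G))                       ≤⟨ ∑-mono-≤ N (λ x _ → χ-∷-≤ x y G) ⟩
    ∑[ x < N ] (𝟙 (x ≟ y) + χ G x)        ≡⟨ ∑-distrib-+ _ _ N ⟩
    ∑[ x < N ] 𝟙 (x ≟ y) + ∑ N (χ G)      ≤⟨ +-mono-≤ (∑𝟙-≟-≤1 y N) (∑χ≤length G N) ⟩
    suc (length G)                        ∎
    where open ≤-Reasoning

  ∑χ≡length : ∀ {G N} → Unique G → All (_< N) G → ∑ N (χ G) ≡ length G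
  ∑χ≡length {[]}    {N} _                 _           = ∑-zero N
  ∑χ≡length {y ∷ G} {N} uniq@(_ ∷ uniqG) (y<N ∷ G<N) = begin
    ∑ N (χ (y ∷ G))                       ≡⟨ ∑-cong N (λ x _ → χ-∷-≡ x (Unique[x∷xs]⇒x∉xs uniq)) ⟩
    ∑[ x < N ] (𝟙 (x ≟ y) + χ G x)        ≡⟨ ∑-distrib-+ _ _ N ⟩
    ∑[ x < N ] 𝟙 (x ≟ y) + ∑ N (χ G)      ≡⟨ cong₂ _+_ (∑𝟙-≟-≡1 y<N) (∑χ≡length uniqG G<N) ⟩
    suc (length G)                        ∎
    where open ≡-Reasoning

  module DownClosed {p} {P : ℕ → Set p} (P? : Decidable P) (P-down : ∀ j → P (suc j) → P j) where

    count : ℕ → ℕ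
    count B = ∑[ i < B ] 𝟙 (P? i)

    P-≤ : ∀ {i j} → i ≤ j → P j → P i
    P-≤ = go ∘ ≤⇒≤′
      where
      go : ∀ {i j} → i ≤′ j → P j → P i
      go ≤′-refl        = λ Pj → Pj
      go (≤′-step i≤′j) = go i≤′j ∘ P-down _

    P⇒<count : ∀ {j} B → P j → j < B → j < count B
    P⇒<count {j} _ Pj j<B with k , refl ← m≤n⇒∃[o]m+o≡n j<B = begin
      suc j                                         ≤⟨ n≤∑ (suc j) (λ i i≤j →
                                                         ≤-reflexive (sym (𝟙-yes (P? i) (P-≤ (s≤s⁻¹ i≤j) Pj)))) ⟩
      count (suc j)                                 ≤⟨ m≤m+n _ _ ⟩
      count (suc j) + ∑[ i < k ] 𝟙 (P? (suc j + i)) ≡⟨ ∑-split (λ i → 𝟙 (P? i)) (suc j) k ⟨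
      count (suc j + k)                             ∎
      where open ≤-Reasoning

    ¬P⇒count≤ : ∀ {j} B → ¬ P j → count B ≤ j
    ¬P⇒count≤ {j} B ¬Pj with ≤-total B j
    ... | inj₁ B≤j = ≤-trans (∑≤n B (λ i _ → 𝟙≤1 (P? i))) B≤j
    ... | inj₂ j≤B with k , refl ← m≤n⇒∃[o]m+o≡n j≤B = begin
      count (j + k)                           ≡⟨ ∑-split (λ i → 𝟙 (P? i)) j k ⟩
      count j + ∑[ i < k ] 𝟙 (P? (j + i))     ≡⟨ cong (count j +_) tail≡0 ⟩
      count j + 0                             ≤⟨ +-monoˡ-≤ 0 (∑≤n j (λ i _ → 𝟙≤1 (P? i))) ⟩
      j + 0                                   ≡⟨ +-identityʳ j ⟩
      j                                       ∎
      where
      open ≤-Reasoning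
      tail≡0 : ∑[ i < k ] 𝟙 (P? (j + i)) ≡ 0
      tail≡0 = trans (∑-cong k (λ i _ → 𝟙-no (P? (j + i)) (¬Pj ∘ P-≤ (m≤m+n j i)))) (∑-zero k)

    <count⇒P : ∀ {j} B → j < count B → P j
    <count⇒P {j} B j<count with P? j
    ... | yes Pj  = Pj
    ... | no  ¬Pj = contradiction (¬P⇒count≤ B ¬Pj) (<⇒≱ j<count)

module ListProperties where

  open import Data.Nat using (ℕ; zero; suc; _*_; _≤_; _<_; z≤n; s≤s; s<s⁻¹)
  open import Data.Nat.Properties
  open import Data.Nat.ListAction using (sum)
  open import Data.List using (List; []; _∷_; applyUpTo; length; map; concatMap)
  open import Data.List.Properties using (∷-injective; length-++; length-removeAt′)
  open import Data.List.Membership.Propositional using (_∈_; _─_)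
  open import Data.List.Relation.Binary.Subset.Propositional using (_⊆_)
  open import Data.List.Relation.Unary.Any using (here; there; index)
  open import Data.List.Relation.Unary.All as All using (All; []; _∷_)
  open import Data.List.Relation.Unary.All.Properties using (map⁺)
  open import Data.List.Relation.Unary.AllPairs using (AllPairs; []; _∷_)
  open import Data.List.Relation.Unary.Unique.Propositional using (Unique)
  open import Data.Product using (_×_; _,_)
  open import Relation.Nullary using (contradiction)
  open import Relation.Binary.PropositionalEquality using (_≡_; _≢_; refl; sym; cong)

  ∈⇒≤sum : ∀ {x xs} → x ∈ xs → x ≤ sum xs
  ∈⇒≤sum              (here refl)  = m≤m+n _ _
  ∈⇒≤sum {xs = y ∷ _} (there x∈xs) = ≤-trans (∈⇒≤sum x∈xs) (m≤n+m _ y)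

  length-concatMap-≤ : ∀ {a b} {A : Set a} {B : Set b} (f : A → List B) {k} xs →
                       (∀ x → length (f x) ≤ k) → length (concatMap f xs) ≤ length xs * k
  length-concatMap-≤ f []       _   = z≤n
  length-concatMap-≤ f (x ∷ xs) f≤k =
    ≤-trans (≤-reflexive (length-++ (f x))) (+-mono-≤ (f≤k x) (length-concatMap-≤ f xs f≤k))

  applyUpTo-injective : ∀ {a} {A : Set a} {m n} {f h : ℕ → A} →
                        applyUpTo f m ≡ applyUpTo h n → m ≡ n × (∀ i → i < m → f i ≡ h i)
  applyUpTo-injective {m = zero}  {zero}  _ = refl , λ _ ()
  applyUpTo-injective {m = suc m} {suc n} eq
    with f0≡h0 , tail≡ ← ∷-injective eq
    with m≡n , f≗h ← applyUpTo-injective tail≡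
    = cong suc m≡n , λ where zero    _   → f0≡h0
                             (suc i) i<m → f≗h i (s<s⁻¹ i<m)

  private
    ∈-∷⇒head-≤ : ∀ {z w ws} → All (z <_) ws → w ∈ z ∷ ws → z ≤ w
    ∈-∷⇒head-≤ _    (here refl) = ≤-refl
    ∈-∷⇒head-≤ z<ws (there w∈)  = <⇒≤ (All.lookup z<ws w∈)

    ∈-∷⇒∈-tail : ∀ {z w ws} → z < w → w ∈ z ∷ ws → w ∈ ws
    ∈-∷⇒∈-tail z<z (here refl) = contradiction z<z (<-irrefl refl)
    ∈-∷⇒∈-tail _   (there w∈)  = w∈

  strictlyIncreasing-⊆-antisym : ∀ {xs ys} → AllPairs _<_ xs → AllPairs _<_ ys → xs ⊆ ys → ys ⊆ xs → xs ≡ ys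
  strictlyIncreasing-⊆-antisym []      []      _     _     = refl
  strictlyIncreasing-⊆-antisym []      (_ ∷ _) _     ys⊆xs with () ← ys⊆xs (here refl)
  strictlyIncreasing-⊆-antisym (_ ∷ _) []      xs⊆ys _     with () ← xs⊆ys (here refl)
  strictlyIncreasing-⊆-antisym {x ∷ _} (x<xs ∷ ↗xs) (y<ys ∷ ↗ys) xs⊆ys ys⊆xs
    with refl ← ≤-antisym (∈-∷⇒head-≤ y<ys (xs⊆ys (here refl))) (∈-∷⇒head-≤ x<xs (ys⊆xs (here refl)))
    = cong (x ∷_) (strictlyIncreasing-⊆-antisym ↗xs ↗ys
        (λ z∈xs → ∈-∷⇒∈-tail (All.lookup x<xs z∈xs) (xs⊆ys (there z∈xs)))
        (λ z∈ys → ∈-∷⇒∈-tail (All.lookup y<ys z∈ys) (ys⊆xs (there z∈ys))))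

  ∈-─ : ∀ {a} {A : Set a} {x y : A} {ys} (x∈ys : x ∈ ys) → y ∈ ys → y ≢ x → y ∈ ys ─ x∈ys
  ∈-─ (here refl) (here refl) y≢x = contradiction refl y≢x
  ∈-─ (here refl) (there y∈)  _   = y∈
  ∈-─ (there x∈)  (here refl) _   = here refl
  ∈-─ (there x∈)  (there y∈)  y≢x = there (∈-─ x∈ y∈ y≢x)

  Unique-⊆⇒length-≤ : ∀ {a} {A : Set a} {xs ys : List A} → Unique xs → xs ⊆ ys → length xs ≤ length ys
  Unique-⊆⇒length-≤ {xs = []}          _             _     = z≤n
  Unique-⊆⇒length-≤ {xs = x ∷ xs} {ys} (x≢xs ∷ uniq) xs⊆ys = begin
    suc (length xs)          ≤⟨ s≤s (Unique-⊆⇒length-≤ uniq xs⊆ys─x) ⟩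
    suc (length (ys ─ x∈ys)) ≡⟨ length-removeAt′ ys (index x∈ys) ⟨
    length ys                ∎
    where
    open ≤-Reasoning
    x∈ys = xs⊆ys (here refl)
    xs⊆ys─x : xs ⊆ ys ─ x∈ys
    xs⊆ys─x y∈xs = ∈-─ x∈ys (xs⊆ys (there y∈xs)) (λ y≡x → All.lookup x≢xs y∈xs (sym y≡x))

  Unique-map⁺-injectiveOn : ∀ {a b p} {A : Set a} {B : Set b} {P : A → Set p} {f : A → B} {xs} →
                (∀ {x y} → P x → P y → f x ≡ f y → x ≡ y) → All P xs → Unique xs → Unique (map f xs)
  Unique-map⁺-injectiveOn inj []         []            = []
  Unique-map⁺-injectiveOn inj (px ∷ pxs) (x≢xs ∷ uniq) =
    map⁺ (All.zipWith (λ (py , x≢y) fx≡fy → x≢y (inj px py fx≡fy)) (pxs , x≢xs)) ∷ Unique-map⁺-injectiveOn inj pxs uniq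

module Compositions where

  open import Defs using (fibs; kFib)
  open import Data.Nat using (ℕ; zero; suc; _+_; _*_; _∸_; _≤_; _<_; z≤n; s≤s; s<s)
  open import Data.Nat.Properties
  open import Data.Nat.ListAction using (sum)
  open import Data.List using (List; []; _∷_; applyUpTo; length; map; _++_; take; drop; concatMap)
  open import Data.List.Properties using (length-++; length-map; length-applyUpTo)
  open import Data.List.Membership.Propositional using (_∈_; lose)
  open import Data.List.Membership.Propositional.Properties
    using (∈-map⁺; ∈-++⁺ˡ; ∈-++⁺ʳ; ∈-concatMap⁺; ∈-applyUpTo⁺)
  open import Data.List.Relation.Unary.Any using (here; there)
  open import Data.List.Relation.Unary.All using (All; []; _∷_)
  open import Data.Product using (_×_; _,_)
  open import Function using (_∘_)
  open import Relation.Binary.PropositionalEquality using (_≡_; refl; sym; trans; cong; cong₂; subst; module ≡-Reasoning)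
  open ListProperties using (length-concatMap-≤)

  prependParts : ℕ → ℕ → List (List (List ℕ)) → List (List ℕ)
  prependParts a zero    _        = []
  prependParts a (suc k) []       = []
  prependParts a (suc k) (S ∷ Ss) = map (a ∷_) S ++ prependParts (suc a) k Ss

  -- compositionTable k n lists the compositions of n − 1, …, of 0 and finally none,
  -- mirroring fibs k n = [F_n, …, F_1, F_0].
  compositionTable : ℕ → ℕ → List (List (List ℕ))
  compositionTable k zero          = [] ∷ []
  compositionTable k (suc zero)    = ([] ∷ []) ∷ [] ∷ []
  compositionTable k (suc (suc n)) = prependParts 1 k (compositionTable k (suc n)) ∷ compositionTable k (suc n)

  compositions : ℕ → ℕ → List (List ℕ)
  compositions k zero    = [] ∷ []
  compositions k (suc n) = prependParts 1 k (compositionTable k (suc n))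

  compositionTable-suc : ∀ k n → compositionTable k (suc n) ≡ compositions k n ∷ compositionTable k n
  compositionTable-suc k zero    = refl
  compositionTable-suc k (suc n) = refl

  drop-compositionTable : ∀ k i n → drop i (compositionTable k (i + n)) ≡ compositionTable k n
  drop-compositionTable k zero    n = refl
  drop-compositionTable k (suc i) n rewrite compositionTable-suc k (i + n) = drop-compositionTable k i n

  ∈-prependParts : ∀ {a k i c S Ss} Sss → i < k → drop i Sss ≡ S ∷ Ss → c ∈ S → a + i ∷ c ∈ prependParts a k Sss
  ∈-prependParts {a} {suc k} {zero}  (S ∷ _)  _         refl c∈S rewrite +-identityʳ a = ∈-++⁺ˡ (∈-map⁺ (a ∷_) c∈S)
  ∈-prependParts {a} {suc k} {suc i} (S ∷ Ss) (s<s i<k) eq   c∈S rewrite +-suc a i =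
    ∈-++⁺ʳ (map (a ∷_) S) (∈-prependParts Ss i<k eq c∈S)

  ∈-compositions : ∀ k c → All (λ a → 1 ≤ a × a ≤ k) c → c ∈ compositions k (sum c)
  ∈-compositions k []          []                 = here refl
  ∈-compositions k (suc i ∷ c) ((_ , i<k) ∷ c-ok) =
    ∈-prependParts (compositionTable k (suc (i + sum c))) i<k table-from-i (∈-compositions k c c-ok)
    where
    table-from-i : drop i (compositionTable k (suc (i + sum c))) ≡ compositions k (sum c) ∷ compositionTable k (sum c)
    table-from-i = begin
      drop i (compositionTable k (suc (i + sum c)))       ≡⟨ cong (drop i ∘ compositionTable k) (+-suc i (sum c)) ⟨
      drop i (compositionTable k (i + suc (sum c)))       ≡⟨ drop-compositionTable k i (suc (sum c)) ⟩
      compositionTable k (suc (sum c))                    ≡⟨ compositionTable-suc k (sum c) ⟩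
      compositions k (sum c) ∷ compositionTable k (sum c) ∎
      where open ≡-Reasoning

  length-prependParts : ∀ a k Sss → length (prependParts a k Sss) ≡ sum (take k (map length Sss))
  length-prependParts a zero    _        = refl
  length-prependParts a (suc k) []       = refl
  length-prependParts a (suc k) (S ∷ Ss) =
    trans (length-++ (map (a ∷_) S)) (cong₂ _+_ (length-map (a ∷_) S) (length-prependParts (suc a) k Ss))

  map-length-compositionTable : ∀ k n → map length (compositionTable k n) ≡ fibs k n
  map-length-compositionTable k zero          = refl
  map-length-compositionTable k (suc zero)    = refl
  map-length-compositionTable k (suc (suc n)) = cong₂ _∷_
    (trans (length-prependParts 1 k (compositionTable k (suc n)))
           (cong (sum ∘ take k) (map-length-compositionTable k (suc n))))
    (map-length-compositionTable k (suc n))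

  kFib-∷ : ∀ {k n x xs} → fibs k n ≡ x ∷ xs → kFib k n ≡ x
  kFib-∷ {k} {n} eq with fibs k n
  kFib-∷ refl | _ = refl

  length-compositions : ∀ k g → length (compositions k g) ≡ kFib k (suc g)
  length-compositions k g = sym (kFib-∷ (begin
    fibs k (suc g)                                                ≡⟨ map-length-compositionTable k (suc g) ⟨
    map length (compositionTable k (suc g))                       ≡⟨ cong (map length) (compositionTable-suc k g) ⟩
    length (compositions k g) ∷ map length (compositionTable k g) ∎))
    where open ≡-Reasoning

  -- A superset of the compositions of g into between 1 and n parts.
  shortCompositions : ℕ → ℕ → List (List ℕ)
  shortCompositions zero    g = []
  shortCompositions (suc n) g =
    (g ∷ []) ∷ concatMap (λ a → map (a ∷_) (shortCompositions n (g ∸ a))) (applyUpTo suc g)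

  ∈-shortCompositions : ∀ {n} c → All (1 ≤_) c → 1 ≤ sum c → length c ≤ n → c ∈ shortCompositions n (sum c)
  ∈-shortCompositions {suc n} (x ∷ [])            _                     _ _           =
    here (cong (_∷ []) (sym (+-identityʳ x)))
  ∈-shortCompositions {suc n} (suc a ∷ c@(y ∷ _)) (_ ∷ c-pos@(1≤y ∷ _)) _ (s≤s len≤n) =
    there (∈-concatMap⁺ _ (lose (∈-applyUpTo⁺ suc (s≤s (m≤m+n a (sum c))))
      (∈-map⁺ (suc a ∷_) (subst (λ g → c ∈ shortCompositions n g) (sym (m+n∸m≡n (suc a) (sum c)))
        (∈-shortCompositions c c-pos (≤-trans 1≤y (m≤m+n y _)) len≤n)))))

  geometricSum : ℕ → ℕ → ℕ
  geometricSum zero    x = 0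
  geometricSum (suc n) x = 1 + x * geometricSum n x

  geometricSum-monoʳ-≤ : ∀ n {x y} → x ≤ y → geometricSum n x ≤ geometricSum n y
  geometricSum-monoʳ-≤ zero    _   = z≤n
  geometricSum-monoʳ-≤ (suc n) x≤y = s≤s (*-mono-≤ x≤y (geometricSum-monoʳ-≤ n x≤y))

  length-shortCompositions : ∀ n g → length (shortCompositions n g) ≤ geometricSum n g
  length-shortCompositions zero    g = z≤n
  length-shortCompositions (suc n) g = s≤s (begin
    length (concatMap extend (applyUpTo suc g)) ≤⟨ length-concatMap-≤ extend (applyUpTo suc g) extend-≤ ⟩
    length (applyUpTo suc g) * geometricSum n g ≡⟨ cong (_* geometricSum n g) (length-applyUpTo suc g) ⟩
    g * geometricSum n g                        ∎)
    where
    open ≤-Reasoning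
    extend : ℕ → List (List ℕ)
    extend a = map (a ∷_) (shortCompositions n (g ∸ a))
    extend-≤ : ∀ a → length (extend a) ≤ geometricSum n g
    extend-≤ a = begin
      length (extend a)                    ≡⟨ length-map (a ∷_) (shortCompositions n (g ∸ a)) ⟩
      length (shortCompositions n (g ∸ a)) ≤⟨ length-shortCompositions n (g ∸ a) ⟩
      geometricSum n (g ∸ a)               ≤⟨ geometricSum-monoʳ-≤ n (m∸n≤m g a) ⟩
      geometricSum n g                     ∎

module Gapsets where

  open import Defs using (IsGapset; IsGapsetOfGenus; kFib; ⌈_/_⌉)
  open import Data.Nat
    using (ℕ; zero; suc; _+_; _*_; _∸_; _≤_; _<_; z≤n; s≤s; s<s; s<s⁻¹; s≤s⁻¹; _≟_; _<?_; NonZero)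
  open import Data.Nat.Properties
  open import Data.Nat.ListAction using (sum)
  open import Data.Nat.DivMod using (_/_; _%_; m*n/n≡m; /-monoˡ-≤; m≡m%n+[m/n]*n; m%n<n)
  open import Algebra.Properties.CommutativeSemigroup +-commutativeSemigroup using (x∙yz≈y∙xz)
  open import Data.Fin using (toℕ; fromℕ; fromℕ<)
  open import Data.Fin.Properties using (¬∀⟶∃¬-smallest; toℕ-fromℕ; toℕ-fromℕ<; toℕ-inject)
  open import Data.List using (List; applyUpTo; length; map; _++_)
  open import Data.List.Properties using (length-++; length-map; length-applyUpTo)
  open import Data.List.Membership.Propositional using (_∈_; _∉_)
  open import Data.List.Membership.Propositional.Properties using (∈-map⁻; ∈-++⁺ˡ; ∈-++⁺ʳ)
  open import Data.List.Membership.DecPropositional _≟_ using (_∈?_)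
  open import Data.List.Relation.Binary.Subset.Propositional using (_⊆_)
  open import Data.List.Relation.Unary.All as All using (All)
  open import Data.List.Relation.Unary.All.Properties using (applyUpTo⁺₁)
  open import Data.List.Relation.Unary.AllPairs as AllPairs using (AllPairs)
  open import Data.List.Relation.Unary.Linked.Properties using (Linked⇒AllPairs)
  open import Data.List.Relation.Unary.Unique.Propositional using (Unique)
  open import Data.Product using (∃; _×_; _,_; proj₁; proj₂)
  open import Data.Sum using (_⊎_; inj₁; inj₂)
  open import Function using (_∘_)
  open import Relation.Nullary using (¬_; yes; no; contradiction)
  open import Relation.Unary using (Decidable)
  open import Relation.Binary.PropositionalEquality using (_≡_; refl; sym; trans; cong; subst; module ≡-Reasoning)
  open FiniteSums
  open ListProperties
  open Compositions

  *≤⇒≤/ : ∀ {a b} d .{{_ : NonZero d}} → a * d ≤ b → a ≤ b / d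
  *≤⇒≤/ {a} d ad≤b = ≤-trans (≤-reflexive (sym (m*n/n≡m a d))) (/-monoˡ-≤ d ad≤b)

  leastCounterexample : ∀ {p} {P : ℕ → Set p} → Decidable P → ∀ b → ¬ P b →
                        ∃ λ n → ¬ P n × (∀ {k} → k < n → P k)
  leastCounterexample {P = P} P? b ¬Pb
    with i , ¬Pi , below ← ¬∀⟶∃¬-smallest (suc b) (P ∘ toℕ) (P? ∘ toℕ)
                             (λ all → ¬Pb (subst P (toℕ-fromℕ b) (all (fromℕ b))))
    = toℕ i , ¬Pi , λ k<i → subst P (trans (toℕ-inject _) (toℕ-fromℕ< k<i)) (below (fromℕ< k<i))

  module _ {G : List ℕ} (gapset : IsGapset G) where

    gapset⇒strictlyIncreasing : AllPairs _<_ G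
    gapset⇒strictlyIncreasing = Linked⇒AllPairs <-trans (proj₂ (proj₁ gapset))

    0∉gapset : 0 ∉ G
    0∉gapset 0∈G with () ← All.lookup (proj₁ (proj₁ gapset)) 0∈G

    gapset-split : ∀ {y z} → z ∈ G → y ≤ z → y ∈ G ⊎ z ∸ y ∈ G
    gapset-split {zero}      z∈G _   = inj₂ z∈G
    gapset-split {suc y} {z} z∈G y≤z with m≤n⇒m<n∨m≡n y≤z
    ... | inj₂ refl = inj₁ z∈G
    ... | inj₁ y<z  = proj₂ gapset z (suc y) (z ∸ suc y) z∈G (s≤s z≤n) (m<n⇒0<n∸m y<z) (sym (m+[n∸m]≡n y≤z))

    gap-cancelˡ : ∀ {a x} → a ∉ G → a + x ∈ G → x ∈ G
    gap-cancelˡ {a} {x} a∉G a+x∈G with gapset-split a+x∈G (m≤m+n a x)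
    ... | inj₁ a∈G = contradiction a∈G a∉G
    ... | inj₂ x∈G = subst (_∈ G) (m+n∸m≡n a x) x∈G

    -- Each of the z + 1 pairs (y, z − y) contains a gap, and each gap lies in at most two pairs.
    gap<2*genus : ∀ {z} → z ∈ G → z < 2 * length G
    gap<2*genus {z} z∈G = begin
      suc z                                       ≤⟨ n≤∑ (suc z) (λ y y≤z → covered (s≤s⁻¹ y≤z)) ⟩
      ∑[ y < suc z ] (χ G y + χ G (z ∸ y))         ≡⟨ ∑-distrib-+ (χ G) (χ G ∘ (z ∸_)) (suc z) ⟩
      ∑ (suc z) (χ G) + ∑[ y < suc z ] χ G (z ∸ y) ≡⟨ cong (∑ (suc z) (χ G) +_) (∑-reverse (χ G) z) ⟩
      ∑ (suc z) (χ G) + ∑ (suc z) (χ G)            ≤⟨ +-mono-≤ (∑χ≤length G (suc z)) (∑χ≤length G (suc z)) ⟩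
      length G + length G                         ≡⟨ cong (length G +_) (+-identityʳ (length G)) ⟨
      2 * length G                                ∎
      where
      open ≤-Reasoning
      covered : ∀ {y} → y ≤ z → 1 ≤ χ G y + χ G (z ∸ y)
      covered {y} y≤z with gapset-split z∈G y≤z
      ... | inj₁ y∈G   = ≤-trans (≤-reflexive (sym (𝟙-yes (y ∈? G) y∈G))) (m≤m+n _ _)
      ... | inj₂ z-y∈G = ≤-trans (≤-reflexive (sym (𝟙-yes (z ∸ y ∈? G) z-y∈G))) (m≤n+m _ _)

  leastNonGap : ∀ G → ∃ λ n → suc n ∉ G × (∀ {k} → k < n → suc k ∈ G)
  leastNonGap G = leastCounterexample (λ k → suc k ∈? G) (sum G) (1+n≰n ∘ ∈⇒≤sum)

  multiplicity : List ℕ → ℕ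
  multiplicity G = suc (proj₁ (leastNonGap G))

  -- Counting only j < 2·genus loses nothing, by gap<2*genus.
  kunzCoordinate : List ℕ → ℕ → ℕ
  kunzCoordinate G r = ∑[ j < 2 * length G ] χ G (r + j * multiplicity G)

  kunzCoordinates : List ℕ → List ℕ
  kunzCoordinates G = applyUpTo (kunzCoordinate G ∘ suc) (multiplicity G ∸ 1)

  module KunzCoordinates {G : List ℕ} (gapset : IsGapset G) where

    private
      m = multiplicity G

    multiplicity∉ : m ∉ G
    multiplicity∉ = proj₁ (proj₂ (leastNonGap G))

    <multiplicity⇒∈ : ∀ {k} → suc k < m → suc k ∈ G
    <multiplicity⇒∈ k<m = proj₂ (proj₂ (leastNonGap G)) (s<s⁻¹ k<m)

    multiple∉ : ∀ j → j * m ∉ G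
    multiple∉ zero    = 0∉gapset gapset
    multiple∉ (suc j) = multiple∉ j ∘ gap-cancelˡ gapset multiplicity∉

    residue-down : ∀ r j → r + suc j * m ∈ G → r + j * m ∈ G
    residue-down r j = gap-cancelˡ gapset multiplicity∉ ∘ subst (_∈ G) (x∙yz≈y∙xz r m (j * m))

    module Residue (r : ℕ) = DownClosed (λ j → r + j * m ∈? G) (residue-down r)

    ∈⇒<kunzCoordinate : ∀ {r j} → r + j * m ∈ G → j < kunzCoordinate G r
    ∈⇒<kunzCoordinate {r} {j} r+jm∈G = Residue.P⇒<count r (2 * length G) r+jm∈G (begin-strict
      j            ≤⟨ m≤m*n j m ⟩
      j * m        ≤⟨ m≤n+m (j * m) r ⟩
      r + j * m    <⟨ gap<2*genus gapset r+jm∈G ⟩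
      2 * length G ∎)
      where open ≤-Reasoning

    <kunzCoordinate⇒∈ : ∀ {r j} → j < kunzCoordinate G r → r + j * m ∈ G
    <kunzCoordinate⇒∈ {r} = Residue.<count⇒P r (2 * length G)

    kunzCoordinate-zero : kunzCoordinate G 0 ≡ 0
    kunzCoordinate-zero =
      trans (∑-cong (2 * length G) (λ j _ → 𝟙-no (j * m ∈? G) (multiple∉ j))) (∑-zero (2 * length G))

    sum-kunzCoordinates : sum (kunzCoordinates G) ≡ length G
    sum-kunzCoordinates = begin
      ∑[ i < m ∸ 1 ] kunzCoordinate G (suc i)
        ≡⟨ cong (_+ ∑[ i < m ∸ 1 ] kunzCoordinate G (suc i)) kunzCoordinate-zero ⟨
      ∑[ r < m ] ∑[ j < B ] χ G (r + j * m)
        ≡⟨ ∑-comm (λ r j → χ G (r + j * m)) m B ⟩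
      ∑[ j < B ] ∑[ r < m ] χ G (r + j * m)
        ≡⟨ ∑-cong B (λ j _ → ∑-cong m λ r _ → cong (χ G) (+-comm r (j * m))) ⟩
      ∑[ j < B ] ∑[ r < m ] χ G (j * m + r)
        ≡⟨ ∑-blocks (χ G) B m ⟨
      ∑ (B * m) (χ G)
        ≡⟨ ∑χ≡length (AllPairs.map <⇒≢ (gapset⇒strictlyIncreasing gapset)) G<Bm ⟩
      length G
        ∎
      where
      open ≡-Reasoning
      B = 2 * length G
      G<Bm : All (_< B * m) G
      G<Bm = All.tabulate (λ x∈G → <-≤-trans (gap<2*genus gapset x∈G) (m≤m*n B m))

    kunzCoordinate-positive : ∀ {k} → suc k < m → 1 ≤ kunzCoordinate G (suc k)
    kunzCoordinate-positive k<m =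
      ∈⇒<kunzCoordinate (subst (_∈ G) (sym (+-identityʳ _)) (<multiplicity⇒∈ k<m))

    -- A coordinate c + 1 makes r + c m a gap, hence below 2g; and m ≥ M + 1.
    kunzCoordinate≤⌈2genus/M+1⌉ : ∀ {M} r → M < m → kunzCoordinate G r ≤ ⌈ 2 * length G / suc M ⌉
    kunzCoordinate≤⌈2genus/M+1⌉ {M} r M<m with kunzCoordinate G r in c≡
    ... | zero  = z≤n
    ... | suc c = *≤⇒≤/ (suc M) (begin
      suc M + c * suc M ≤⟨ +-monoʳ-≤ (suc M) (*-monoʳ-≤ c M<m) ⟩
      suc M + c * m     ≡⟨ +-suc M (c * m) ⟨
      M + suc (c * m)   ≤⟨ +-monoʳ-≤ M (≤-<-trans (m≤n+m (c * m) r) (gap<2*genus gapset r+cm∈G)) ⟩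
      M + 2 * length G  ≡⟨ +-comm M _ ⟩
      2 * length G + M  ∎)
      where
      open ≤-Reasoning
      r+cm∈G : r + c * m ∈ G
      r+cm∈G = <kunzCoordinate⇒∈ (subst (c <_) (sym c≡) ≤-refl)

  kunzCoordinates-⊆ : ∀ {G G'} → IsGapset G → IsGapset G' → kunzCoordinates G ≡ kunzCoordinates G' → G ⊆ G'
  kunzCoordinates-⊆ {G} {G'} gapset gapset' eq {x} x∈G
    with n≡n' , c≗c' ← applyUpTo-injective eq
    with x % multiplicity G | x / multiplicity G | m≡m%n+[m/n]*n x (multiplicity G) | m%n<n x (multiplicity G)
  ... | zero  | j | x≡jm     | _   = contradiction (subst (_∈ G) x≡jm x∈G) (KunzCoordinates.multiple∉ gapset j)
  ... | suc i | j | x≡i+1+jm | r<m = subst (_∈ G') x≡ (KunzCoordinates.<kunzCoordinate⇒∈ gapset' j<c')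
    where
    x≡ : suc i + j * multiplicity G' ≡ x
    x≡ = trans (cong (λ m → suc i + j * m) (sym (cong suc n≡n'))) (sym x≡i+1+jm)
    j<c' : j < kunzCoordinate G' (suc i)
    j<c' = subst (j <_) (c≗c' i (s<s⁻¹ r<m))
             (KunzCoordinates.∈⇒<kunzCoordinate gapset (subst (_∈ G) x≡i+1+jm x∈G))

  kunzCoordinates-injective : ∀ {G G'} → IsGapset G → IsGapset G' → kunzCoordinates G ≡ kunzCoordinates G' → G ≡ G'
  kunzCoordinates-injective gapset gapset' eq =
    strictlyIncreasing-⊆-antisym (gapset⇒strictlyIncreasing gapset) (gapset⇒strictlyIncreasing gapset')
      (kunzCoordinates-⊆ gapset gapset' eq) (kunzCoordinates-⊆ gapset' gapset (sym eq))

  kunzCandidates : ℕ → ℕ → List (List ℕ)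
  kunzCandidates M g = compositions ⌈ 2 * g / suc M ⌉ g ++ shortCompositions (M ∸ 1) g

  kunzCoordinates∈kunzCandidates : ∀ M {G} → IsGapset G → 1 ≤ length G → kunzCoordinates G ∈ kunzCandidates M (length G)
  kunzCoordinates∈kunzCandidates M {G} gapset 1≤g with M <? multiplicity G
  ... | yes M<m = ∈-++⁺ˡ (subst (λ g → kunzCoordinates G ∈ compositions K g) sum-kunzCoordinates
          (∈-compositions K (kunzCoordinates G) (applyUpTo⁺₁ _ _ λ i<n →
            kunzCoordinate-positive (s<s i<n) , kunzCoordinate≤⌈2genus/M+1⌉ _ M<m)))
    where
    open KunzCoordinates gapset
    K = ⌈ 2 * length G / suc M ⌉
  ... | no M≮m = ∈-++⁺ʳ (compositions ⌈ 2 * length G / suc M ⌉ (length G))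
          (subst (λ g → kunzCoordinates G ∈ shortCompositions (M ∸ 1) g) sum-kunzCoordinates
          (∈-shortCompositions (kunzCoordinates G) (applyUpTo⁺₁ _ _ λ i<n → kunzCoordinate-positive (s<s i<n))
            (subst (1 ≤_) (sym sum-kunzCoordinates) 1≤g)
            (≤-trans (≤-reflexive (length-applyUpTo _ _)) (∸-monoˡ-≤ 1 (≮⇒≥ M≮m)))))
    where open KunzCoordinates gapset

  gapsetsOfGenus-≤ : ∀ M {g} → 1 ≤ g → (Gs : List (List ℕ)) → All (IsGapsetOfGenus g) Gs → Unique Gs →
                     length Gs ≤ kFib ⌈ 2 * g / suc M ⌉ (suc g) + geometricSum (M ∸ 1) g
  gapsetsOfGenus-≤ M {g} 1≤g Gs genus-g uniq = begin
    length Gs                                                 ≡⟨ length-map kunzCoordinates Gs ⟨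
    length (map kunzCoordinates Gs)                           ≤⟨ Unique-⊆⇒length-≤ unique-codes codes⊆candidates ⟩
    length (kunzCandidates M g)                               ≡⟨ length-++ (compositions ⌈ 2 * g / suc M ⌉ g) ⟩
    length (compositions ⌈ 2 * g / suc M ⌉ g) + length (shortCompositions (M ∸ 1) g)
                                                              ≤⟨ +-mono-≤ (≤-reflexive (length-compositions _ g))
                                                                          (length-shortCompositions (M ∸ 1) g) ⟩
    kFib ⌈ 2 * g / suc M ⌉ (suc g) + geometricSum (M ∸ 1) g   ∎
    where
    open ≤-Reasoning
    unique-codes : Unique (map kunzCoordinates Gs)
    unique-codes = Unique-map⁺-injectiveOn
      (λ (gapset , _) (gapset' , _) → kunzCoordinates-injective gapset gapset') genus-g uniq
    codes⊆candidates : map kunzCoordinates Gs ⊆ kunzCandidates M g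
    codes⊆candidates c∈codes with G , G∈Gs , refl ← ∈-map⁻ kunzCoordinates c∈codes
      with gapset , refl ← All.lookup genus-g G∈Gs = kunzCoordinates∈kunzCandidates M gapset 1≤g

module Polynomials where

  open import Defs using (ℕ→ℚ; QuasiPolynomial; HasDegree; coeffAt; evalQP)
  open import Data.Nat as ℕ using (ℕ; zero; suc; s≤s)
  open import Data.Nat.Properties using (n<1+n)
  open import Data.Fin using (zero)
  open import Data.Integer as ℤ using (+_; _⊖_; +<+; +≤+)
  import Data.Integer.Properties as ℤP
  open import Data.Rational as ℚ using (1ℚ; 0ℚ; toℚᵘ)
  open import Data.Rational.Properties
    using (toℚᵘ-injective; toℚᵘ-fromℚᵘ; toℚᵘ-homo-+; toℚᵘ-homo-*; toℚᵘ-cancel-≤)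
  open import Data.Rational.Unnormalised as ℚᵘ using (mkℚᵘ; *≡*; *≤*; _≃_)
  import Data.Rational.Unnormalised.Properties as ℚᵘP
  open import Data.List using (replicate)
  open import Data.Product using (_,_)
  open import Data.Empty using (⊥)
  open import Relation.Binary.PropositionalEquality using (_≡_; refl; sym; trans; cong; cong₂; module ≡-Reasoning)
  open Compositions using (geometricSum)

  toℚᵘ-ℕ→ℚ : ∀ n → toℚᵘ (ℕ→ℚ n) ≃ mkℚᵘ (+ n) 0
  toℚᵘ-ℕ→ℚ n = toℚᵘ-fromℚᵘ (mkℚᵘ (+ n) 0)

  ℕ→ℚ-+ : ∀ a b → ℕ→ℚ (a ℕ.+ b) ≡ ℕ→ℚ a ℚ.+ ℕ→ℚ b
  ℕ→ℚ-+ a b = toℚᵘ-injective (begin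
    toℚᵘ (ℕ→ℚ (a ℕ.+ b))           ≈⟨ toℚᵘ-ℕ→ℚ (a ℕ.+ b) ⟩
    mkℚᵘ (+ (a ℕ.+ b)) 0           ≈⟨ *≡* (cong (ℤ._* + 1) (trans (ℤP.pos-+ a b)
                                        (sym (cong₂ ℤ._+_ (ℤP.*-identityʳ (+ a)) (ℤP.*-identityʳ (+ b)))))) ⟩
    mkℚᵘ (+ a) 0 ℚᵘ.+ mkℚᵘ (+ b) 0 ≈⟨ ℚᵘP.+-cong (toℚᵘ-ℕ→ℚ a) (toℚᵘ-ℕ→ℚ b) ⟨
    toℚᵘ (ℕ→ℚ a) ℚᵘ.+ toℚᵘ (ℕ→ℚ b) ≈⟨ toℚᵘ-homo-+ (ℕ→ℚ a) (ℕ→ℚ b) ⟨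
    toℚᵘ (ℕ→ℚ a ℚ.+ ℕ→ℚ b)         ∎)
    where open ℚᵘP.≃-Reasoning

  ℕ→ℚ-* : ∀ a b → ℕ→ℚ (a ℕ.* b) ≡ ℕ→ℚ a ℚ.* ℕ→ℚ b
  ℕ→ℚ-* a b = toℚᵘ-injective (begin
    toℚᵘ (ℕ→ℚ (a ℕ.* b))           ≈⟨ toℚᵘ-ℕ→ℚ (a ℕ.* b) ⟩
    mkℚᵘ (+ (a ℕ.* b)) 0           ≈⟨ *≡* (cong (ℤ._* + 1) (ℤP.pos-* a b)) ⟩
    mkℚᵘ (+ a) 0 ℚᵘ.* mkℚᵘ (+ b) 0 ≈⟨ ℚᵘP.*-cong (toℚᵘ-ℕ→ℚ a) (toℚᵘ-ℕ→ℚ b) ⟨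
    toℚᵘ (ℕ→ℚ a) ℚᵘ.* toℚᵘ (ℕ→ℚ b) ≈⟨ toℚᵘ-homo-* (ℕ→ℚ a) (ℕ→ℚ b) ⟨
    toℚᵘ (ℕ→ℚ a ℚ.* ℕ→ℚ b)         ∎)
    where open ℚᵘP.≃-Reasoning

  ℕ→ℚ-mono-≤ : ∀ {a b} → a ℕ.≤ b → ℕ→ℚ a ℚ.≤ ℕ→ℚ b
  ℕ→ℚ-mono-≤ {a} {b} a≤b = toℚᵘ-cancel-≤ (begin
    toℚᵘ (ℕ→ℚ a) ≃⟨ toℚᵘ-ℕ→ℚ a ⟩
    mkℚᵘ (+ a) 0 ≤⟨ *≤* (ℤP.*-monoʳ-≤-nonNeg (+ 1) (+≤+ a≤b)) ⟩
    mkℚᵘ (+ b) 0 ≃⟨ toℚᵘ-ℕ→ℚ b ⟨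
    toℚᵘ (ℕ→ℚ b) ∎)
    where open ℚᵘP.≤-Reasoning

  onesPolynomial : ℕ → QuasiPolynomial
  onesPolynomial n = record { period = 1 ; coeffs = λ _ → replicate n 1ℚ }

  coeffAt-replicate-≥ : ∀ {n j} c → n ℕ.≤ j → coeffAt (replicate n c) j ≡ 0ℚ
  coeffAt-replicate-≥ {zero}          c _         = refl
  coeffAt-replicate-≥ {suc n} {suc j} c (s≤s n≤j) = coeffAt-replicate-≥ c n≤j

  coeffAt-replicate-< : ∀ {n j} c → j ℕ.< n → coeffAt (replicate n c) j ≡ c
  coeffAt-replicate-< {suc n} {zero}  c _         = refl
  coeffAt-replicate-< {suc n} {suc j} c (s≤s j<n) = coeffAt-replicate-< c j<n

  degree-onesPolynomial : ∀ n → HasDegree (onesPolynomial n) (n ⊖ 1)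
  degree-onesPolynomial zero    = (λ _ _ _ → refl) , λ _ ()
  degree-onesPolynomial (suc n) =
    (λ { _ _ (+<+ n<j) → coeffAt-replicate-≥ 1ℚ n<j }) ,
    λ { _ refl → zero , λ coeff≡0 → 1ℚ≢0ℚ (trans (sym (coeffAt-replicate-< 1ℚ (n<1+n n))) coeff≡0) }
    where
    1ℚ≢0ℚ : 1ℚ ≡ 0ℚ → ⊥
    1ℚ≢0ℚ ()

  evalQP-onesPolynomial : ∀ n g → evalQP (onesPolynomial n) g ≡ ℕ→ℚ (geometricSum n g)
  evalQP-onesPolynomial zero    g = refl
  evalQP-onesPolynomial (suc n) g = begin
    1ℚ ℚ.+ ℕ→ℚ g ℚ.* evalQP (onesPolynomial n) g
      ≡⟨ cong (λ q → 1ℚ ℚ.+ ℕ→ℚ g ℚ.* q) (evalQP-onesPolynomial n g) ⟩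
    ℕ→ℚ 1 ℚ.+ ℕ→ℚ g ℚ.* ℕ→ℚ (geometricSum n g)
      ≡⟨ cong (ℕ→ℚ 1 ℚ.+_) (ℕ→ℚ-* g (geometricSum n g)) ⟨
    ℕ→ℚ 1 ℚ.+ ℕ→ℚ (g ℕ.* geometricSum n g)
      ≡⟨ ℕ→ℚ-+ 1 (g ℕ.* geometricSum n g) ⟨
    ℕ→ℚ (geometricSum (suc n) g)
      ∎
    where open ≡-Reasoning

open import Defs
open import Data.Nat using (ℕ; suc; _≤_; _*_)
open import Data.Integer using (+_; _-_)
open import Data.Rational using (_+_) renaming (_≤_ to _≤ℚ_)
open import Data.List using (List; length)
open import Data.List.Relation.Unary.All using (All)
open import Data.List.Relation.Unary.Unique.Propositional using (Unique)
open import Data.Product using (Σ; _×_; _,_)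
open import Data.Integer.Properties using ([1+m]⊖[1+n]≡m⊖n)
open import Data.Rational.Properties using (module ≤-Reasoning)
open import Relation.Binary.PropositionalEquality using (sym; cong; subst)
open Compositions using (geometricSum)
open Gapsets using (gapsetsOfGenus-≤)
open Polynomials

corollary6p10 : (M : ℕ) → 1 ≤ M →
    Σ QuasiPolynomial λ p → HasDegree p (+ M - + 2) ×
      Σ ℕ λ g₀ → (g : ℕ) → g₀ ≤ g →
        (Gs : List (List ℕ)) → All (IsGapsetOfGenus g) Gs → Unique Gs →
          ℕ→ℚ (length Gs) ≤ℚ ℕ→ℚ (kFib ⌈ 2 * g / suc M ⌉ (suc g)) + evalQP p g
corollary6p10 (suc n) _ = onesPolynomial n , degree , 1 , bound
  where
  degree : HasDegree (onesPolynomial n) (+ suc n - + 2)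
  degree = subst (HasDegree (onesPolynomial n)) (sym ([1+m]⊖[1+n]≡m⊖n n 1)) (degree-onesPolynomial n)

  bound : ∀ g → 1 ≤ g → (Gs : List (List ℕ)) → All (IsGapsetOfGenus g) Gs → Unique Gs →
          ℕ→ℚ (length Gs) ≤ℚ ℕ→ℚ (kFib ⌈ 2 * g / suc (suc n) ⌉ (suc g)) + evalQP (onesPolynomial n) g
  bound g 1≤g Gs genus-g uniq = begin
    ℕ→ℚ (length Gs)                          ≤⟨ ℕ→ℚ-mono-≤ (gapsetsOfGenus-≤ (suc n) 1≤g Gs genus-g uniq) ⟩
    ℕ→ℚ (F Data.Nat.+ geometricSum n g)      ≡⟨ ℕ→ℚ-+ F (geometricSum n g) ⟩
    ℕ→ℚ F + ℕ→ℚ (geometricSum n g)           ≡⟨ cong (λ q → ℕ→ℚ F + q) (evalQP-onesPolynomial n g) ⟨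
    ℕ→ℚ F + evalQP (onesPolynomial n) g      ∎
    where
    open ≤-Reasoning
    F = kFib ⌈ 2 * g / suc (suc n) ⌉ (suc g)
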